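{- Let $\mathcal E$ be an edge replacement system and $\mathcal R_{\mathcal E}$ its associated VERS (any choice of partitions). If $\alpha=a_1a_2\cdots$ and $\beta=b_1b_2\cdots$ in $\Omega$ are related by the gluing relation of $\mathcal E$, then, viewed as infinite directed paths in $\Sigma$ starting at $s$, they are asymptotically equivalent, i.e. $\sup_{k}d(a_1\cdots a_k,\ b_1\cdots b_k)<\infty$, where $d$ is the graph distance in the history graph of $\mathcal R_{\mathcal E}$.
   Context: Graphs have vertex set, edge set and maps $\iota,\tau$; loops and parallel edges allowed; adjacency and distances ignore orientation. Words are read left to right; letters appended on the right. ERS $\mathcal E$: finite color set $C$, finite base graph $X_0$ with $C$-colored edges, for each $c\in C$ a finite replacement graph $X_c$ with $C$-colored edges and distinguished vertices $\iota_c,\tau_c$; expanding a $c$-colored edge $e$ replaces it by a copy of $X_c$, identifying $\iota_c$ with $\iota(e)$, $\tau_c$ with $\tau(e)$. Full expansion sequence: $E_1=X_0$, $E_{n+1}$ obtained by expanding every edge of $E_n$; the edges of $E_n$ are the words $e_1\cdots e_n$ with $e_1\in E(X_0)$, $e_{i+1}\in E(X_{\mathrm{col}(e_i)})$. The symbol space $\Omega$ is the set of infinite words $e_1e_2\cdots$ all of whose prefixes $e_1\cdots e_n$ are edges of $E_n$. Gluing relation: $x_1x_2\cdots\sim y_1y_2\cdots$ iff for every $n$, the edges $x_1\cdots x_n$ and $y_1\cdots y_n$ of $E_n$ are equal or adjacent. Barycentric subdivision $\mathrm{bar}(Y)$ of a $C$-colored graph: vertices $V(Y)\sqcup E(Y)$;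 for each edge $e$ of color $c$, edges $\iota(e)\to e$ colored $c_\iota$ and $e\to\tau(e)$ colored $c_\tau$. VERS $\mathcal R_{\mathcal E}$: $\Sigma$ has vertices $C\sqcup\{\ast,s\}$ and edges: loop $V$ at $\ast$; $e\colon c\to c'$ for each edge $e$ of $X_c$ of color $c'$; $v\colon c\to\ast$ for $v\in V(X_c)\setminus\{\iota_c,\tau_c\}$; $e\colon s\to c$ for each edge $e$ of $X_0$ of color $c$; $v\colon s\to\ast$ for $v\in V(X_0)$ (labels distinct). Types of words = terminal vertex in $\Sigma$ of the path from $s$. Colors $\{c_0\}\sqcup C_\iota\sqcup C_\tau$. For each $c$ fix a partition of $\mathrm{bar}(X_c)$ into subgraphs $B_\iota,B_\tau$ (vertex sets covering, edge sets disjoint and covering) with $\tau_c\notin V(B_\iota)$, $\iota_c\notin V(B_\tau)$. $R_{c_\iota}$: edges of $B_\iota$ renamed by $\iota_c\mapsto\mathrm iV$, $z\mapsto\mathrm tz$ otherwise; $R_{c_\tau}$: edges of $B_\tau$ renamed by $\tau_c\mapsto\mathrm tV$, $z\mapsto\mathrm iz$ otherwise; $R_{c_0}$: for each edge $e$ of $X_0$ of color $c$, a $c_\iota$-edge $\mathrm i\,\iota(e)\to\mathrm te$ and a $c_\tau$-edge $\mathrm ie\to\mathrm t\,\tau(e)$. $\Gamma_0$: one $c_0$-colored loop at the empty word $\varepsilon$. Expansion of a typed graph $\Gamma$: vertices $ux$ ($u\in V(\Gamma)$, $x\in E(\Sigma)$, $\iota(x)=\mathrm{type}(u)$); for each edge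 of $\Gamma$ from $u$ to $v$ of color $c'$ and each edge of $R_{c'}$, an edge of the same color with $\mathrm i\mapsto u$, $\mathrm t\mapsto v$ in its endpoints. $\Gamma_{n+1}$ is the expansion of $\Gamma_n$. The history graph has vertex set the finite directed paths in $\Sigma$ from $s$ (words), vertical edges $w\to wx$, and horizontal edges all edges of all $\Gamma_n$. -}

module Defs where

open import Data.Nat using (ℕ; zero; suc)
open import Data.Fin using (Fin; _≟_)
open import Data.Bool using (Bool; true; false; not; _∧_; if_then_else_; T)
open import Data.Unit using (⊤; tt)
open import Data.Product using (Σ; ∃; _×_; _,_; proj₁; proj₂)
open import Data.Sum using (_⊎_)
open import Relation.Nullary using (¬_)
open import Relation.Nullary.Decidable using (⌊_⌋)
open import Relation.Binary.PropositionalEquality using (_≡_)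

record CGraph (nC : ℕ) : Set where
  field
    nV nE : ℕ
    src tgt : Fin nE → Fin nV
    col : Fin nE → Fin nC

record ERS : Set where
  field
    nC : ℕ
    X0 : CGraph nC
    X  : Fin nC → CGraph nC
    ιc τc : (c : Fin nC) → Fin (CGraph.nV (X c))

module ERSDefs (𝓔 : ERS) where
  open ERS 𝓔

  C : Set
  C = Fin nC

  V0 E0 : Set
  V0 = Fin (CGraph.nV X0)
  E0 = Fin (CGraph.nE X0)
  ι0 τ0 : E0 → V0
  ι0 = CGraph.src X0
  τ0 = CGraph.tgt X0
  col0 : E0 → C
  col0 = CGraph.col X0

  VX EX : C → Set
  VX c = Fin (CGraph.nV (X c))
  EX c = Fin (CGraph.nE (X c))
  ιX τX : (c : C) → EX c → VX c
  ιX c = CGraph.src (X c)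
  τX c = CGraph.tgt (X c)
  colX : (c : C) → EX c → C
  colX c = CGraph.col (X c)

  -- Edges of E_n are the words e₁⋯eₙ with
  -- e₁ ∈ E(X₀), e_{i+1} ∈ E(X_{col eᵢ}); EW c = such words whose last
  -- letter has colour c (words are built by appending on the right).

  data EW : C → Set where
    base : (e : E0) → EW (col0 e)
    _∷ʳ_ : ∀ {c} → EW c → (e : EX c) → EW (colX c e)

  -- Vertices of the graphs E_n: a vertex of X₀, or the copy of an
  -- internal vertex v (v ∉ {ι_c, τ_c}) of X_c created when expanding the
  -- c-coloured edge w.  (Vertices persist along the sequence.)
  data Vtx : Set where
    vbase  : V0 → Vtx
    vinner : ∀ {c} → EW c → VX c → Vtx

  -- endpoints of an edge of E_n: expanding w identifies ι_c with ι(w)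
  -- and τ_c with τ(w)
  mutual
    ιE : ∀ {c} → EW c → Vtx
    ιE (base e) = vbase (ι0 e)
    ιE {_} (_∷ʳ_ {c} w e) = liftV w (ιX c e)

    τE : ∀ {c} → EW c → Vtx
    τE (base e) = vbase (τ0 e)
    τE {_} (_∷ʳ_ {c} w e) = liftV w (τX c e)

    liftV : ∀ {c} → EW c → VX c → Vtx
    liftV {c} w v =
      if ⌊ v ≟ ιc c ⌋ then ιE w else (if ⌊ v ≟ τc c ⌋ then τE w else vinner w v)

  AdjE : ∀ {c c'} → EW c → EW c' → Set
  AdjE x y = (ιE x ≡ ιE y) ⊎ (ιE x ≡ τE y) ⊎ (τE x ≡ ιE y) ⊎ (τE x ≡ τE y)

  -- Symbol space Ω: an infinite word e₁e₂⋯ given by its prefixes;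
  -- seq n = e₁⋯e_{n+1} (an edge of E_{n+1}).
  record Ω : Set where
    field
      seq  : ℕ → Σ C EW
      seq0 : ∃ λ (e : E0) → seq 0 ≡ (col0 e , base e)
      seqS : ∀ n → ∃ λ (e : EX (proj₁ (seq n))) →
               seq (suc n) ≡ (colX (proj₁ (seq n)) e , (proj₂ (seq n) ∷ʳ e))
  open Ω public

  Glued : Ω → Ω → Set
  Glued α β = ∀ n → (seq α n ≡ seq β n) ⊎ AdjE (proj₂ (seq α n)) (proj₂ (seq β n))

  data SV : Set where
    scol : C → SV
    star : SV
    ssrc : SV

  isInner : (c : C) → VX c → Bool
  isInner c v = not ⌊ v ≟ ιc c ⌋ ∧ not ⌊ v ≟ τc c ⌋

  Out : SV → Set
  Out (scol c) = EX c ⊎ Σ (VX c) (λ v → T (isInner c v))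
  Out star = ⊤
  Out ssrc = E0 ⊎ V0

  target : (x : SV) → Out x → SV
  target (scol c) (Data.Sum.inj₁ e) = scol (colX c e)
  target (scol c) (Data.Sum.inj₂ _) = star
  target star _ = star
  target ssrc (Data.Sum.inj₁ e) = scol (col0 e)
  target ssrc (Data.Sum.inj₂ _) = star

  -- words = finite directed paths in Σ from s, indexed by their type
  data Word : SV → Set where
    []  : Word ssrc
    _▷_ : ∀ {x} → Word x → (o : Out x) → Word (target x o)

  Wd : Set
  Wd = Σ SV Word

  ε : Wd
  ε = (ssrc , [])

  toWord : ∀ {c} → EW c → Word (scol c)
  toWord (base e) = [] ▷ Data.Sum.inj₁ e
  toWord (w ∷ʳ e) = toWord w ▷ Data.Sum.inj₁ e

  prefix : Ω → ℕ → Wd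
  prefix α zero = ε
  prefix α (suc n) = (scol (proj₁ (seq α n)) , toWord (proj₂ (seq α n)))

  -- formal labels of Σ-edges (untyped); Ext u x u' : u' = u x
  data Lbl : Set where
    lV  : Lbl
    lE  : (c : C) → EX c → Lbl
    lv  : (c : C) → VX c → Lbl
    l0E : E0 → Lbl
    l0v : V0 → Lbl

  data Ext : Wd → Lbl → Wd → Set where
    xV  : (w : Word star) → Ext (star , w) lV (star , (w ▷ tt))
    xE  : (c : C) (w : Word (scol c)) (e : EX c) →
          Ext (scol c , w) (lE c e) (scol (colX c e) , (w ▷ Data.Sum.inj₁ e))
    xv  : (c : C) (w : Word (scol c)) (v : VX c) (p : T (isInner c v)) →
          Ext (scol c , w) (lv c v) (star , (w ▷ Data.Sum.inj₂ (v , p)))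
    x0E : (w : Word ssrc) (e : E0) →
          Ext (ssrc , w) (l0E e) (scol (col0 e) , (w ▷ Data.Sum.inj₁ e))
    x0v : (w : Word ssrc) (v : V0) →
          Ext (ssrc , w) (l0v v) (star , (w ▷ Data.Sum.inj₂ v))

  data VCol : Set where
    c0 : VCol
    cι cτ : C → VCol

  data BarV (c : C) : Set where
    bv : VX c → BarV c
    be : EX c → BarV c

  -- (e , false) is the edge ι(e) → e (colour col(e)_ι),
  -- (e , true)  is the edge e → τ(e) (colour col(e)_τ)
  BarE : C → Set
  BarE c = EX c × Bool

  barSrc barTgt : (c : C) → BarE c → BarV c
  barSrc c (e , false) = bv (ιX c e)
  barSrc c (e , true)  = be e
  barTgt c (e , false) = be e
  barTgt c (e , true)  = bv (τX c e)

  barCol : (c : C) → BarE c → VCol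
  barCol c (e , false) = cι (colX c e)
  barCol c (e , true)  = cτ (colX c e)

  record Partition (c : C) : Set where
    field
      inBι : BarE c → Bool          -- true: edge of B_ι; false: edge of B_τ
      Vι Vτ : BarV c → Bool
      cover : ∀ z → T (Vι z) ⊎ T (Vτ z)
      closedι : ∀ b → T (inBι b) → T (Vι (barSrc c b)) × T (Vι (barTgt c b))
      closedτ : ∀ b → T (not (inBι b)) → T (Vτ (barSrc c b)) × T (Vτ (barTgt c b))
      τ∉Bι : ¬ T (Vι (bv (τc c)))
      ι∉Bτ : ¬ T (Vτ (bv (ιc c)))
  open Partition public

  -- endpoints of replacement-graph edges: "i x" or "t x"
  data Side : Set where
    sI sT : Side

  Spec : Set
  Spec = Side × Lbl

  renι : (c : C) → BarV c → Spec
  renι c (bv v) = if ⌊ v ≟ ιc c ⌋ then (sI , lV) else (sT , lv c v)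
  renι c (be e) = (sT , lE c e)

  renτ : (c : C) → BarV c → Spec
  renτ c (bv v) = if ⌊ v ≟ τc c ⌋ then (sT , lV) else (sI , lv c v)
  renτ c (be e) = (sI , lE c e)

  module VERS (P : (c : C) → Partition c) where

    REdge : VCol → Set
    REdge c0 = E0 × Bool
    REdge (cι c) = Σ (BarE c) (λ b → T (inBι (P c) b))
    REdge (cτ c) = Σ (BarE c) (λ b → T (not (inBι (P c) b)))

    rcol : (κ : VCol) → REdge κ → VCol
    rcol c0 (e , false) = cι (col0 e)
    rcol c0 (e , true)  = cτ (col0 e)
    rcol (cι c) (b , _) = barCol c b
    rcol (cτ c) (b , _) = barCol c b

    rsrc rtgt : (κ : VCol) → REdge κ → Spec
    rsrc c0 (e , false) = (sI , l0v (ι0 e))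
    rsrc c0 (e , true)  = (sI , l0E e)
    rsrc (cι c) (b , _) = renι c (barSrc c b)
    rsrc (cτ c) (b , _) = renτ c (barSrc c b)
    rtgt c0 (e , false) = (sT , l0E e)
    rtgt c0 (e , true)  = (sT , l0v (τ0 e))
    rtgt (cι c) (b , _) = renι c (barTgt c b)
    rtgt (cτ c) (b , _) = renτ c (barTgt c b)

    At : Wd → Wd → Spec → Wd → Set
    At u v (sI , x) w = Ext u x w
    At u v (sT , x) w = Ext v x w

    -- Hor κ u v : some Γ_n has a κ-coloured edge u → v
    data Hor : VCol → Wd → Wd → Set where
      h0    : Hor c0 ε ε
      hstep : ∀ {κ u v u' v'} → Hor κ u v → (r : REdge κ) →
              At u v (rsrc κ r) u' → At u v (rtgt κ r) v' → Hor (rcol κ r) u' v'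

    Adj : Wd → Wd → Set
    Adj w w' = (∃ λ x → Ext w x w') ⊎ (∃ λ x → Ext w' x w)
             ⊎ (∃ λ κ → Hor κ w w') ⊎ (∃ λ κ → Hor κ w' w)

    -- Reach n w w' : d(w, w') ≤ n in the history graph
    data Reach : ℕ → Wd → Wd → Set where
      here : ∀ {n w} → Reach n w w
      step : ∀ {n w w₁ w'} → Adj w w₁ → Reach n w₁ w' → Reach (suc n) w w'

    AsympEquiv : (ℕ → Wd) → (ℕ → Wd) → Set
    AsympEquiv p q = ∃ λ (M : ℕ) → ∀ k → Reach M (p k) (q k)

-- Every edge w of E_n, read as a word of Σ, is joined in Γ_n by a c_ι-coloured edge to a
-- word representing ι(w) and by a c_τ-coloured edge to one representing τ(w): for w = w'e these
-- come from expanding such an edge at w' through the bar(X_c)-edge ι(e) → e or e → τ(e), which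
-- lies in B_ι or B_τ, and the partition condition keeps its other endpoint away from τ_c or ι_c.
-- The representing words depend only on the vertex of E_n (the word at which the vertex is
-- born, followed by loops V), so adjacent edges of E_n share a neighbour in the history
-- graph.  Glued sequences have equal or adjacent prefixes, hence stay within distance 2.
module Submission where

open import Defs
open import Data.Nat using (ℕ; zero; suc; _+_; _∸_)
open import Data.Nat.Properties using (m+n∸m≡n; +-suc)
open import Data.Fin using (_≟_)
open import Data.Bool using (Bool; true; false; not; T; if_then_else_)
open import Data.Bool.Properties using (T-∧; T-irrelevant)
open import Data.Unit using (tt)
open import Data.Empty using (⊥-elim)
open import Data.Product using (∃₂; _,_; proj₁; proj₂)
open import Data.Sum using (_⊎_; inj₁; inj₂)
open import Function.Bundles using (Equivalence)
open import Relation.Nullary using (¬_; Dec; yes; no)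
open import Relation.Nullary.Decidable using (⌊_⌋; fromWitnessFalse)
open import Relation.Binary.PropositionalEquality
  using (_≡_; refl; sym; trans; cong; cong₂; subst; module ≡-Reasoning)

T-or-T-not : (b : Bool) → T b ⊎ T (not b)
T-or-T-not true = inj₁ tt
T-or-T-not false = inj₂ tt

module _ (𝓔 : ERS) where
  open ERS 𝓔
  open ERSDefs 𝓔

  depth : ∀ {c} → EW c → ℕ
  depth (base e) = 1
  depth (w ∷ʳ e) = suc (depth w)

  depth-seq : (α : Ω) (n : ℕ) → depth (proj₂ (seq α n)) ≡ suc n
  depth-seq α zero with seq0 α
  ... | e , eq = cong (λ s → depth (proj₂ s)) eq
  depth-seq α (suc n) with seqS α n
  ... | e , eq = trans (cong (λ s → depth (proj₂ s)) eq) (cong suc (depth-seq α n))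

  endX : Side → (c : C) → EX c → VX c
  endX sI = ιX
  endX sT = τX

  endE : Side → ∀ {c} → EW c → Vtx
  endE sI = ιE
  endE sT = τE

  isInner-intro : ∀ {c} {v : VX c} → ¬ v ≡ ιc c → ¬ v ≡ τc c → T (isInner c v)
  isInner-intro {c} {v} ¬ι ¬τ =
    Equivalence.from T-∧ (fromWitnessFalse {a? = v ≟ ιc c} ¬ι , fromWitnessFalse {a? = v ≟ τc c} ¬τ)

  -- The word of Γ_n at which the vertex endE s w of E_n sits, for n = depth w.
  mutual
    endWord : Side → ∀ {c} → EW c → Word star
    endWord sI (base e) = [] ▷ inj₂ (ι0 e)
    endWord sT (base e) = [] ▷ inj₂ (τ0 e)
    endWord s (_∷ʳ_ {c} w e) = liftWord w v (v ≟ ιc c) (v ≟ τc c)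
      where v = endX s c e

    -- The decisions are arguments so that lemmas can case on them in step with liftV.
    liftWord : ∀ {c} → EW c → (v : VX c) → Dec (v ≡ ιc c) → Dec (v ≡ τc c) → Word star
    liftWord w v (yes _) _ = endWord sI w ▷ tt
    liftWord w v (no _) (yes _) = endWord sT w ▷ tt
    liftWord w v (no ¬ι) (no ¬τ) = toWord w ▷ inj₂ (v , isInner-intro ¬ι ¬τ)

  liftWord-inner : ∀ {c} (w : EW c) {v : VX c} → ¬ v ≡ ιc c → ¬ v ≡ τc c →
                   (v≟ι : Dec (v ≡ ιc c)) (v≟τ : Dec (v ≡ τc c)) (p : T (isInner c v)) →
                   liftWord w v v≟ι v≟τ ≡ toWord w ▷ inj₂ (v , p)
  liftWord-inner w ¬ι ¬τ (yes v≡ι) _ p = ⊥-elim (¬ι v≡ι)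
  liftWord-inner w ¬ι ¬τ (no _) (yes v≡τ) p = ⊥-elim (¬τ v≡τ)
  liftWord-inner w {v} ¬ι ¬τ (no _) (no _) p =
    cong (λ q → toWord w ▷ inj₂ (v , q)) (T-irrelevant _ _)

  _▷V^_ : Word star → ℕ → Word star
  u ▷V^ zero = u
  u ▷V^ suc m = (u ▷ tt) ▷V^ m

  -- The word of Γ_k at which a vertex of E_k sits: the word at its birth, followed by loops V.
  vertexWord : ℕ → Vtx → Word star
  vertexWord k (vbase v) = ([] ▷ inj₂ v) ▷V^ (k ∸ 1)
  vertexWord k (vinner {c} w v) = liftWord w v (v ≟ ιc c) (v ≟ τc c) ▷V^ (k ∸ suc (depth w))

  mutual
    vertexWord-endE : ∀ s {c} (w : EW c) m → vertexWord (depth w + m) (endE s w) ≡ endWord s w ▷V^ m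
    vertexWord-endE sI (base e) m = refl
    vertexWord-endE sT (base e) m = refl
    vertexWord-endE sI (w ∷ʳ e) m = vertexWord-liftV w _ _ m
    vertexWord-endE sT (w ∷ʳ e) m = vertexWord-liftV w _ _ m

    vertexWord-liftV : ∀ {c} (w : EW c) {v : VX c} (v≟ι : Dec (v ≡ ιc c)) (v≟τ : Dec (v ≡ τc c)) m →
      vertexWord (suc (depth w) + m) (if ⌊ v≟ι ⌋ then ιE w else (if ⌊ v≟τ ⌋ then τE w else vinner w v))
      ≡ liftWord w v v≟ι v≟τ ▷V^ m
    vertexWord-liftV w (yes _) _ m =
      trans (cong (λ k → vertexWord k (ιE w)) (sym (+-suc (depth w) m))) (vertexWord-endE sI w (suc m))
    vertexWord-liftV w (no _) (yes _) m =
      trans (cong (λ k → vertexWord k (τE w)) (sym (+-suc (depth w) m))) (vertexWord-endE sT w (suc m))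
    vertexWord-liftV {c} w {v} (no ¬ι) (no ¬τ) m =
      cong₂ _▷V^_ (liftWord-inner w ¬ι ¬τ (v ≟ ιc c) (v ≟ τc c) _) (m+n∸m≡n (suc (depth w)) m)

  endWord-unique : ∀ s s′ {c c′} (x : EW c) (y : EW c′) →
                   depth x ≡ depth y → endE s x ≡ endE s′ y → endWord s x ≡ endWord s′ y
  endWord-unique s s′ x y same-depth same-vertex = begin
    endWord s x                         ≡⟨ sym (vertexWord-endE s x 0) ⟩
    vertexWord (depth x + 0) (endE s x)  ≡⟨ cong₂ (λ k → vertexWord (k + 0)) same-depth same-vertex ⟩
    vertexWord (depth y + 0) (endE s′ y) ≡⟨ vertexWord-endE s′ y 0 ⟩
    endWord s′ y                        ∎
    where open ≡-Reasoning

  shared-endpoint : ∀ {c c′} {x : EW c} {y : EW c′} → AdjE x y → ∃₂ λ s s′ → endE s x ≡ endE s′ y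
  shared-endpoint (inj₁ q) = sI , sI , q
  shared-endpoint (inj₂ (inj₁ q)) = sI , sT , q
  shared-endpoint (inj₂ (inj₂ (inj₁ q))) = sT , sI , q
  shared-endpoint (inj₂ (inj₂ (inj₂ q))) = sT , sT , q

  module _ (P : (c : C) → Partition c) where
    open VERS P

    Adj-sym : ∀ {u v} → Adj u v → Adj v u
    Adj-sym (inj₁ x) = inj₂ (inj₁ x)
    Adj-sym (inj₂ (inj₁ x)) = inj₁ x
    Adj-sym (inj₂ (inj₂ (inj₁ h))) = inj₂ (inj₂ (inj₂ h))
    Adj-sym (inj₂ (inj₂ (inj₂ h))) = inj₂ (inj₂ (inj₁ h))

    Bι-vertex≢τ : ∀ {c} {v : VX c} → T (Vι (P c) (bv v)) → ¬ v ≡ τc c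
    Bι-vertex≢τ {c} p refl = τ∉Bι (P c) p

    Bτ-vertex≢ι : ∀ {c} {v : VX c} → T (Vτ (P c) (bv v)) → ¬ v ≡ ιc c
    Bτ-vertex≢ι {c} p refl = ι∉Bτ (P c) p

    -- The vertex z of bar(X_c), in the copy of R_{c_ι} or R_{c_τ} that expands the word of w.
    barWord : ∀ {c} → EW c → BarV c → Wd
    barWord {c} w (bv v) = star , liftWord w v (v ≟ ιc c) (v ≟ τc c)
    barWord {c} w (be e) = scol (colX c e) , (toWord w ▷ inj₁ e)

    ι-liftWord-at : ∀ {c} (w : EW c) {v : VX c} → ¬ v ≡ τc c →
                    (v≟ι : Dec (v ≡ ιc c)) (v≟τ : Dec (v ≡ τc c)) →
                    At (star , endWord sI w) (scol c , toWord w)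
                       (if ⌊ v≟ι ⌋ then (sI , lV) else (sT , lv c v)) (star , liftWord w v v≟ι v≟τ)
    ι-liftWord-at w ¬τ (yes _) _ = xV (endWord sI w)
    ι-liftWord-at w ¬τ (no _) (yes v≡τ) = ⊥-elim (¬τ v≡τ)
    ι-liftWord-at {c} w {v} ¬τ (no ¬ι) (no ¬τ′) = xv c (toWord w) v (isInner-intro ¬ι ¬τ′)

    τ-liftWord-at : ∀ {c} (w : EW c) {v : VX c} → ¬ v ≡ ιc c →
                    (v≟ι : Dec (v ≡ ιc c)) (v≟τ : Dec (v ≡ τc c)) →
                    At (scol c , toWord w) (star , endWord sT w)
                       (if ⌊ v≟τ ⌋ then (sT , lV) else (sI , lv c v)) (star , liftWord w v v≟ι v≟τ)
    τ-liftWord-at w ¬ι (yes v≡ι) _ = ⊥-elim (¬ι v≡ι)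
    τ-liftWord-at w ¬ι (no _) (yes _) = xV (endWord sT w)
    τ-liftWord-at {c} w {v} ¬ι (no ¬ι′) (no ¬τ) = xv c (toWord w) v (isInner-intro ¬ι′ ¬τ)

    Bι-vertex-at : ∀ {c} (w : EW c) (z : BarV c) → T (Vι (P c) z) →
                   At (star , endWord sI w) (scol c , toWord w) (renι c z) (barWord w z)
    Bι-vertex-at {c} w (bv v) p = ι-liftWord-at w (Bι-vertex≢τ p) (v ≟ ιc c) (v ≟ τc c)
    Bι-vertex-at {c} w (be e) p = xE c (toWord w) e

    Bτ-vertex-at : ∀ {c} (w : EW c) (z : BarV c) → T (Vτ (P c) z) →
                   At (scol c , toWord w) (star , endWord sT w) (renτ c z) (barWord w z)
    Bτ-vertex-at {c} w (bv v) p = τ-liftWord-at w (Bτ-vertex≢ι p) (v ≟ ιc c) (v ≟ τc c)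
    Bτ-vertex-at {c} w (be e) p = xE c (toWord w) e

    mutual
      ι-hor : ∀ {c} (w : EW c) → Hor (cι c) (star , endWord sI w) (scol c , toWord w)
      ι-hor (base e) = hstep h0 (e , false) (x0v [] (ι0 e)) (x0E [] e)
      ι-hor (w ∷ʳ e) = bar-hor w (e , false)

      τ-hor : ∀ {c} (w : EW c) → Hor (cτ c) (scol c , toWord w) (star , endWord sT w)
      τ-hor (base e) = hstep h0 (e , true) (x0E [] e) (x0v [] (τ0 e))
      τ-hor (w ∷ʳ e) = bar-hor w (e , true)

      bar-hor : ∀ {c} (w : EW c) (b : BarE c) →
                Hor (barCol c b) (barWord w (barSrc c b)) (barWord w (barTgt c b))
      bar-hor {c} w b with T-or-T-not (inBι (P c) b)
      ... | inj₁ b∈Bι = hstep (ι-hor w) (b , b∈Bι)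
                          (Bι-vertex-at w (barSrc c b) (proj₁ (closedι (P c) b b∈Bι)))
                          (Bι-vertex-at w (barTgt c b) (proj₂ (closedι (P c) b b∈Bι)))
      ... | inj₂ b∈Bτ = hstep (τ-hor w) (b , b∈Bτ)
                          (Bτ-vertex-at w (barSrc c b) (proj₁ (closedτ (P c) b b∈Bτ)))
                          (Bτ-vertex-at w (barTgt c b) (proj₂ (closedτ (P c) b b∈Bτ)))

    endWord-adj : ∀ s {c} (w : EW c) → Adj (scol c , toWord w) (star , endWord s w)
    endWord-adj sI w = inj₂ (inj₂ (inj₂ (_ , ι-hor w)))
    endWord-adj sT w = inj₂ (inj₂ (inj₁ (_ , τ-hor w)))

    AdjE⇒Reach2 : ∀ {c c′} (x : EW c) (y : EW c′) → depth x ≡ depth y → AdjE x y →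
                  Reach 2 (scol c , toWord x) (scol c′ , toWord y)
    AdjE⇒Reach2 {c′ = c′} x y same-depth adj with shared-endpoint adj
    ... | s , s′ , same-vertex =
      step (endWord-adj s x) (step (subst (λ u → Adj (star , u) (scol c′ , toWord y))
                                          (sym (endWord-unique s s′ x y same-depth same-vertex))
                                          (Adj-sym (endWord-adj s′ y))) here)

    Glued⇒prefixes-Reach2 : ∀ {α β} → Glued α β → ∀ k → Reach 2 (prefix α k) (prefix β k)
    Glued⇒prefixes-Reach2 g zero = here
    Glued⇒prefixes-Reach2 {α} {β} g (suc n) with g n
    ... | inj₁ eq = subst (λ s → Reach 2 (prefix α (suc n)) (scol (proj₁ s) , toWord (proj₂ s))) eq here
    ... | inj₂ adj = AdjE⇒Reach2 _ _ (trans (depth-seq α n) (sym (depth-seq β n))) adj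

proposition6p13 : (𝓔 : ERS) (P : (c : ERSDefs.C 𝓔) → ERSDefs.Partition 𝓔 c)
    (α β : ERSDefs.Ω 𝓔) → ERSDefs.Glued 𝓔 α β →
    ERSDefs.VERS.AsympEquiv 𝓔 P (ERSDefs.prefix 𝓔 α) (ERSDefs.prefix 𝓔 β)
proposition6p13 𝓔 P α β g = 2 , Glued⇒prefixes-Reach2 𝓔 P g
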